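{- Let $\omega = \tfrac12 + \tfrac{\sqrt{ -7}}{2}$ and $\mathcal{E}_{ -7} = \{ n \in \mathbb{Z}[\omega] : |n|^2 \le 2\}$. For every $n \in \mathbb{Z}[\omega] \setminus \mathcal{E}_{ -7}$ there exist nonzero $a,b,c \in \mathbb{Z}[\omega]$ with $\frac{4}{n} = \frac1a + \frac1b + \frac1c$.
   Context: $\mathbb{Z}[\omega]$ is the ring of integers of $\mathbb{Q}(\sqrt{ -7})$; for $n = x + y\omega$ with $x,y\in\mathbb{Z}$, $|n|^2 = x^2 + xy + 2y^2$. -}

module Defs where

open import Data.Integer using (ℤ; +_; _+_; _*_; -_; _-_)
open import Data.Product using (_×_; _,_)
open import Relation.Binary.PropositionalEquality using (_≡_)
open import Relation.Nullary using (¬_)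

-- ω = 1/2 + √-7/2 satisfies ω² = ω - 2.
-- An element x + y ω of ℤ[ω] is represented by the pair (x , y).
record ℤω : Set where
  constructor _+_ω
  field
    re : ℤ
    im : ℤ

open ℤω public

infixl 6 _⊕_
infixl 7 _⊗_

_⊕_ : ℤω → ℤω → ℤω
(a + b ω) ⊕ (c + d ω) = (a + c) + (b + d) ω

-- (a + bω)(c + dω) = ac + (ad + bc)ω + bd ω² = (ac - 2bd) + (ad + bc + bd)ω
_⊗_ : ℤω → ℤω → ℤω
(a + b ω) ⊗ (c + d ω) = (a * c - + 2 * (b * d)) + (a * d + b * c + b * d) ω

0ω : ℤω
0ω = (+ 0) + (+ 0) ω

4ω : ℤω
4ω = (+ 4) + (+ 0) ω

normSq : ℤω → ℤ
normSq (x + y ω) = x * x + x * y + + 2 * (y * y)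

-- The proof works modulo the prime 2 = ω·ω̄ (ω̄ = 1 - ω), which splits in ℤ[ω].
-- Solutions scale: if 4/m = 1/a + 1/b + 1/c then 4/(dm) = 1/(da) + 1/(db) + 1/(dc).
-- So it suffices to solve the equation for a few "base" shapes:
--   * n = 2h:        4/(2h)   = 1/h + 1/(2h) + 1/(2h);
--   * n = 2K + 1:    4/(2K+1) = 1/(K+1) + 1/K - 1/(K(K+1)(2K+1))   (K ≠ 0, -1);
--   * n = ω², ω̄²:    4/ω² = ω̄² = -1 - ω = 1/(-1) + 2/(-ω̄), and symmetrically.
-- A parity analysis of the coordinates of n = x + yω shows that every n is 2h,
-- d·(2K+1) with d ∈ {1, ω, ω̄}, or a multiple of ω² or ω̄².  In the odd case the
-- excluded values K = 0, -1 give n = ±d, of norm ≤ 2; every other case only needs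
-- n ≠ 0.  Nonvanishing of the scaled denominators comes from ℤ[ω] being an integral
-- domain, which follows from the multiplicative, positive definite norm.
module Submission where

open import Defs
open import Data.Integer using (ℤ; +_; _≤_)
open import Data.Product using (Σ; _×_)
open import Relation.Binary.PropositionalEquality using (_≡_)
open import Relation.Nullary using (¬_)

open import Data.Nat as ℕ using (ℕ; suc; s≤s; z≤n)
open import Data.Integer using (_+_; _*_; -_; _-_; ∣_∣; -[1+_]; +≤+)
import Data.Integer.Properties as ℤ
import Data.Nat.Properties as ℕ
open import Data.Integer.DivMod using (_%ℕ_; _/ℕ_; n%ℕd<d; a≡a%ℕn+[a/ℕn]*n)
open import Data.Integer.Solver using (module +-*-Solver)
import Data.Integer.Tactic.RingSolver as ℤ-Tactic
open import Data.List using (_∷_; [])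
open import Data.Maybe using (Maybe; just; nothing)
open import Data.Product using (_,_; proj₁; proj₂)
open import Data.Sum using (_⊎_; inj₁; inj₂; reduce; [_,_]′)
open import Relation.Binary.PropositionalEquality
  using (refl; sym; trans; cong; cong₂; subst; isEquivalence; module ≡-Reasoning)
open import Algebra.Bundles using (CommutativeRing)
open import Algebra.Structures {A = ℤω} _≡_ using (IsCommutativeRing)
open import Algebra.Consequences.Propositional
  using (comm∧idˡ⇒id; comm∧invˡ⇒inv; comm∧distrˡ⇒distrʳ)
import Tactic.RingSolver as RingTactic
import Tactic.RingSolver.Core.AlmostCommutativeRing as ACR

⊖_ : ℤω → ℤω
⊖ (a + b ω) = (- a) + (- b) ω

1ω 2ω omega omegaBar : ℤω
1ω       = (+ 1) + (+ 0) ω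
2ω       = (+ 2) + (+ 0) ω
omega    = (+ 0) + (+ 1) ω
omegaBar = (+ 1) + (- + 1) ω

-- Evaluating these pairs
-- reproduces _⊕_ and _⊗_ definitionally, so an identity between ℤ[ω]-expressions
-- in explicit coordinates splits into two identities checked by the ℤ-ring solver.
module Formal where
  open +-*-Solver public using (Polynomial; solve; _:=_; _:+_; _:*_; _:-_; :-_; con)

  Pair : ℕ → Set
  Pair k = Polynomial k × Polynomial k

  infixl 6 _⊕ᶠ_
  infixl 7 _⊗ᶠ_

  _⊕ᶠ_ _⊗ᶠ_ : ∀ {k} → Pair k → Pair k → Pair k
  (a , b) ⊕ᶠ (c , d) = (a :+ c) , (b :+ d)
  (a , b) ⊗ᶠ (c , d) = (a :* c :- con (+ 2) :* (b :* d)) , (a :* d :+ b :* c :+ b :* d)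

  1ᶠ 2ᶠ ωᶠ ω̄ᶠ : ∀ {k} → Pair k
  1ᶠ = con (+ 1) , con (+ 0)
  2ᶠ = con (+ 2) , con (+ 0)
  ωᶠ = con (+ 0) , con (+ 1)
  ω̄ᶠ = con (+ 1) , con (- + 1)

  normᶠ : ∀ {k} → Pair k → Polynomial k
  normᶠ (a , b) = a :* a :+ a :* b :+ con (+ 2) :* (b :* b)

open Formal

⊕-assoc : ∀ x y z → (x ⊕ y) ⊕ z ≡ x ⊕ (y ⊕ z)
⊕-assoc (a + b ω) (c + d ω) (e + f ω) = cong₂ _+_ω (ℤ.+-assoc a c e) (ℤ.+-assoc b d f)

⊕-comm : ∀ x y → x ⊕ y ≡ y ⊕ x
⊕-comm (a + b ω) (c + d ω) = cong₂ _+_ω (ℤ.+-comm a c) (ℤ.+-comm b d)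

⊕-identityˡ : ∀ x → 0ω ⊕ x ≡ x
⊕-identityˡ (a + b ω) = cong₂ _+_ω (ℤ.+-identityˡ a) (ℤ.+-identityˡ b)

⊖-inverseˡ : ∀ x → (⊖ x) ⊕ x ≡ 0ω
⊖-inverseˡ (a + b ω) = cong₂ _+_ω (ℤ.+-inverseˡ a) (ℤ.+-inverseˡ b)

⊗-assoc : ∀ x y z → (x ⊗ y) ⊗ z ≡ x ⊗ (y ⊗ z)
⊗-assoc (a + b ω) (c + d ω) (e + f ω) = cong₂ _+_ω
  (solve 6 (λ a b c d e f → proj₁ ((a , b) ⊗ᶠ (c , d) ⊗ᶠ (e , f)) := proj₁ ((a , b) ⊗ᶠ ((c , d) ⊗ᶠ (e , f)))) refl a b c d e f)
  (solve 6 (λ a b c d e f → proj₂ ((a , b) ⊗ᶠ (c , d) ⊗ᶠ (e , f)) := proj₂ ((a , b) ⊗ᶠ ((c , d) ⊗ᶠ (e , f)))) refl a b c d e f)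

⊗-comm : ∀ x y → x ⊗ y ≡ y ⊗ x
⊗-comm (a + b ω) (c + d ω) = cong₂ _+_ω
  (solve 4 (λ a b c d → proj₁ ((a , b) ⊗ᶠ (c , d)) := proj₁ ((c , d) ⊗ᶠ (a , b))) refl a b c d)
  (solve 4 (λ a b c d → proj₂ ((a , b) ⊗ᶠ (c , d)) := proj₂ ((c , d) ⊗ᶠ (a , b))) refl a b c d)

⊗-identityˡ : ∀ x → 1ω ⊗ x ≡ x
⊗-identityˡ (a + b ω) = cong₂ _+_ω
  (solve 2 (λ a b → proj₁ (1ᶠ ⊗ᶠ (a , b)) := a) refl a b)
  (solve 2 (λ a b → proj₂ (1ᶠ ⊗ᶠ (a , b)) := b) refl a b)

⊗-distribˡ : ∀ x y z → x ⊗ (y ⊕ z) ≡ x ⊗ y ⊕ x ⊗ z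
⊗-distribˡ (a + b ω) (c + d ω) (e + f ω) = cong₂ _+_ω
  (solve 6 (λ a b c d e f → proj₁ ((a , b) ⊗ᶠ ((c , d) ⊕ᶠ (e , f))) := proj₁ ((a , b) ⊗ᶠ (c , d) ⊕ᶠ (a , b) ⊗ᶠ (e , f))) refl a b c d e f)
  (solve 6 (λ a b c d e f → proj₂ ((a , b) ⊗ᶠ ((c , d) ⊕ᶠ (e , f))) := proj₂ ((a , b) ⊗ᶠ (c , d) ⊕ᶠ (a , b) ⊗ᶠ (e , f))) refl a b c d e f)

ℤω-isCommutativeRing : IsCommutativeRing _⊕_ _⊗_ ⊖_ 0ω 1ω
ℤω-isCommutativeRing = record
  { isRing = record
    { +-isAbelianGroup = record
      { isGroup = record
        { isMonoid = record
          { isSemigroup = record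
            { isMagma = record { isEquivalence = isEquivalence ; ∙-cong = cong₂ _⊕_ }
            ; assoc = ⊕-assoc }
          ; identity = comm∧idˡ⇒id ⊕-comm ⊕-identityˡ }
        ; inverse = comm∧invˡ⇒inv ⊕-comm ⊖-inverseˡ
        ; ⁻¹-cong = cong ⊖_ }
      ; comm = ⊕-comm }
    ; *-cong = cong₂ _⊗_
    ; *-assoc = ⊗-assoc
    ; *-identity = comm∧idˡ⇒id ⊗-comm ⊗-identityˡ
    ; distrib = ⊗-distribˡ , comm∧distrˡ⇒distrʳ ⊗-comm ⊗-distribˡ }
  ; *-comm = ⊗-comm }

ℤω-commutativeRing : CommutativeRing _ _
ℤω-commutativeRing = record { isCommutativeRing = ℤω-isCommutativeRing }

open CommutativeRing ℤω-commutativeRing using (zeroˡ; zeroʳ)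

-- The ring packaged for the reflective ring solver, which needs to recognise 0.
ℤω-ring : ACR.AlmostCommutativeRing _ _
ℤω-ring = ACR.fromCommutativeRing ℤω-commutativeRing isZero
  where
  isZero : (x : ℤω) → Maybe (0ω ≡ x)
  isZero ((+ 0) + (+ 0) ω) = just refl
  isZero _                 = nothing

normSq-⊗ : ∀ x y → normSq (x ⊗ y) ≡ normSq x * normSq y
normSq-⊗ (a + b ω) (c + d ω) =
  solve 4 (λ a b c d → normᶠ ((a , b) ⊗ᶠ (c , d)) := normᶠ (a , b) :* normᶠ (c , d)) refl a b c d

square-∣∣ : ∀ i → i * i ≡ + (∣ i ∣ ℕ.* ∣ i ∣)
square-∣∣ (+ n)     = ℤ.+◃n≡+n (n ℕ.* n)
square-∣∣ -[1+ n ] = ℤ.+◃n≡+n (suc n ℕ.* suc n)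

positive-form-definite : ∀ k u v → u * u + + suc k * (v * v) ≡ + 0 → u ≡ + 0 × v ≡ + 0
positive-form-definite k u v sum≡0 = square≡0 u U≡0 , square≡0 v V≡0
  where
  square≡0 : ∀ i → ∣ i ∣ ℕ.* ∣ i ∣ ≡ 0 → i ≡ + 0
  square≡0 i p = ℤ.∣i∣≡0⇒i≡0 (reduce (ℕ.m*n≡0⇒m≡0∨n≡0 ∣ i ∣ p))
  inℕ : ∣ u ∣ ℕ.* ∣ u ∣ ℕ.+ suc k ℕ.* (∣ v ∣ ℕ.* ∣ v ∣) ≡ 0
  inℕ = ℤ.+-injective (begin
    + (∣ u ∣ ℕ.* ∣ u ∣ ℕ.+ suc k ℕ.* (∣ v ∣ ℕ.* ∣ v ∣))       ≡⟨ ℤ.pos-+ (∣ u ∣ ℕ.* ∣ u ∣) _ ⟩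
    + (∣ u ∣ ℕ.* ∣ u ∣) + + (suc k ℕ.* (∣ v ∣ ℕ.* ∣ v ∣))      ≡⟨ cong (λ t → + (∣ u ∣ ℕ.* ∣ u ∣) + t) (ℤ.pos-* (suc k) _) ⟩
    + (∣ u ∣ ℕ.* ∣ u ∣) + + suc k * + (∣ v ∣ ℕ.* ∣ v ∣)        ≡⟨ cong₂ (λ s t → s + + suc k * t) (sym (square-∣∣ u)) (sym (square-∣∣ v)) ⟩
    u * u + + suc k * (v * v)                                    ≡⟨ sum≡0 ⟩
    + 0                                                          ∎)
    where open ≡-Reasoning
  U≡0 : ∣ u ∣ ℕ.* ∣ u ∣ ≡ 0
  U≡0 = ℕ.m+n≡0⇒m≡0 (∣ u ∣ ℕ.* ∣ u ∣) inℕ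
  V≡0 : ∣ v ∣ ℕ.* ∣ v ∣ ≡ 0
  V≡0 with ℕ.m*n≡0⇒m≡0∨n≡0 (suc k) (ℕ.m+n≡0⇒n≡0 (∣ u ∣ ℕ.* ∣ u ∣) inℕ)
  ... | inj₂ p = p

-- 4·|x + yω|² = (2x + y)² + 7y², hence the norm vanishes only at 0.
normSq-definite : ∀ x → normSq x ≡ + 0 → x ≡ 0ω
normSq-definite (a + b ω) N≡0 = cong₂ _+_ω a≡0 b≡0
  where
  open ≡-Reasoning
  completed : (+ 2 * a + b) * (+ 2 * a + b) + + 7 * (b * b) ≡ + 0
  completed = begin
    (+ 2 * a + b) * (+ 2 * a + b) + + 7 * (b * b)
      ≡⟨ solve 2 (λ a b → (con (+ 2) :* a :+ b) :* (con (+ 2) :* a :+ b) :+ con (+ 7) :* (b :* b)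
                          := con (+ 4) :* normᶠ (a , b)) refl a b ⟩
    + 4 * (a * a + a * b + + 2 * (b * b))
      ≡⟨ cong (+ 4 *_) N≡0 ⟩
    + 0 ∎
  2a+b≡0×b≡0 : + 2 * a + b ≡ + 0 × b ≡ + 0
  2a+b≡0×b≡0 = positive-form-definite 6 (+ 2 * a + b) b completed
  b≡0 : b ≡ + 0
  b≡0 = proj₂ 2a+b≡0×b≡0
  2a≡0 : + 2 * a ≡ + 0
  2a≡0 = begin
    + 2 * a       ≡⟨ ℤ.+-identityʳ (+ 2 * a) ⟨
    + 2 * a + + 0 ≡⟨ cong (λ t → + 2 * a + t) b≡0 ⟨
    + 2 * a + b   ≡⟨ proj₁ 2a+b≡0×b≡0 ⟩
    + 0           ∎
  a≡0 : a ≡ + 0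
  a≡0 with ℤ.i*j≡0⇒i≡0∨j≡0 (+ 2) {a} 2a≡0
  ... | inj₂ p = p

⊗-nonzero : ∀ {x y} → ¬ x ≡ 0ω → ¬ y ≡ 0ω → ¬ x ⊗ y ≡ 0ω
⊗-nonzero {x} {y} x≢0 y≢0 xy≡0 =
  [ (λ Nx≡0 → x≢0 (normSq-definite x Nx≡0)) , (λ Ny≡0 → y≢0 (normSq-definite y Ny≡0)) ]′
    (ℤ.i*j≡0⇒i≡0∨j≡0 (normSq x) {normSq y} N≡0)
  where
  N≡0 : normSq x * normSq y ≡ + 0
  N≡0 = trans (sym (normSq-⊗ x y)) (cong normSq xy≡0)

-- The equation 4/n = 1/a + 1/b + 1/c with denominators cleared.
EgyptianEq : ℤω → ℤω → ℤω → ℤω → Set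
EgyptianEq n a b c = 4ω ⊗ a ⊗ b ⊗ c ≡ n ⊗ (b ⊗ c ⊕ a ⊗ c ⊕ a ⊗ b)

Representable : ℤω → Set
Representable n = Σ ℤω λ a → Σ ℤω λ b → Σ ℤω λ c →
  ¬ (a ≡ 0ω) × ¬ (b ≡ 0ω) × ¬ (c ≡ 0ω) × EgyptianEq n a b c

-- Scaling n, a, b, c by d multiplies both sides of the equation by d³.
EgyptianEq-scale : ∀ d {n a b c} → EgyptianEq n a b c → EgyptianEq (d ⊗ n) (d ⊗ a) (d ⊗ b) (d ⊗ c)
EgyptianEq-scale d {n} {a} {b} {c} eq = begin
  4ω ⊗ (d ⊗ a) ⊗ (d ⊗ b) ⊗ (d ⊗ c)             ≡⟨ RingTactic.solve (a ∷ b ∷ c ∷ d ∷ []) ℤω-ring ⟩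
  d ⊗ d ⊗ d ⊗ (4ω ⊗ a ⊗ b ⊗ c)                 ≡⟨ cong (d ⊗ d ⊗ d ⊗_) eq ⟩
  d ⊗ d ⊗ d ⊗ (n ⊗ (b ⊗ c ⊕ a ⊗ c ⊕ a ⊗ b))    ≡⟨ RingTactic.solve (n ∷ a ∷ b ∷ c ∷ d ∷ []) ℤω-ring ⟩
  d ⊗ n ⊗ ((d ⊗ b) ⊗ (d ⊗ c) ⊕ (d ⊗ a) ⊗ (d ⊗ c) ⊕ (d ⊗ a) ⊗ (d ⊗ b)) ∎
  where open ≡-Reasoning

representable-scale : ∀ d {m} → ¬ d ≡ 0ω → Representable m → Representable (d ⊗ m)
representable-scale d d≢0 (a , b , c , a≢0 , b≢0 , c≢0 , eq) =
  d ⊗ a , d ⊗ b , d ⊗ c , ⊗-nonzero d≢0 a≢0 , ⊗-nonzero d≢0 b≢0 , ⊗-nonzero d≢0 c≢0 ,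
  EgyptianEq-scale d eq

representable-twice : ∀ h → ¬ h ≡ 0ω → Representable (2ω ⊗ h)
representable-twice h h≢0 =
  h , 2ω ⊗ h , 2ω ⊗ h , h≢0 , ⊗-nonzero {2ω} (λ ()) h≢0 , ⊗-nonzero {2ω} (λ ()) h≢0 , identity h
  where
  identity : ∀ h → 4ω ⊗ h ⊗ (2ω ⊗ h) ⊗ (2ω ⊗ h) ≡ 2ω ⊗ h ⊗ ((2ω ⊗ h) ⊗ (2ω ⊗ h) ⊕ h ⊗ (2ω ⊗ h) ⊕ h ⊗ (2ω ⊗ h))
  identity = RingTactic.solve-∀ ℤω-ring

-- 4/(2K+1) = 1/(K+1) + 1/K - 1/((2K+1)(K+1)K).
representable-odd : ∀ K → ¬ K ≡ 0ω → ¬ K ⊕ 1ω ≡ 0ω → ¬ 2ω ⊗ K ⊕ 1ω ≡ 0ω →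
                    Representable (2ω ⊗ K ⊕ 1ω)
representable-odd K K≢0 K+1≢0 2K+1≢0 =
  K ⊕ 1ω , K , ⊖ 1ω ⊗ ((2ω ⊗ K ⊕ 1ω) ⊗ (K ⊕ 1ω) ⊗ K) ,
  K+1≢0 , K≢0 , ⊗-nonzero {⊖ 1ω} (λ ()) (⊗-nonzero (⊗-nonzero 2K+1≢0 K+1≢0) K≢0) , identity K
  where
  identity : ∀ K → let c = ⊖ 1ω ⊗ ((2ω ⊗ K ⊕ 1ω) ⊗ (K ⊕ 1ω) ⊗ K) in
    4ω ⊗ (K ⊕ 1ω) ⊗ K ⊗ c ≡ (2ω ⊗ K ⊕ 1ω) ⊗ (K ⊗ c ⊕ (K ⊕ 1ω) ⊗ c ⊕ (K ⊕ 1ω) ⊗ K)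
  identity = RingTactic.solve-∀ ℤω-ring

-- 4/ω² = ω̄² = -1 - ω = 1/(-1) + 1/(-ω̄) + 1/(-ω̄), and conjugately for ω̄².
representable-omega² : Representable (omega ⊗ omega)
representable-omega² = ⊖ 1ω , ⊖ omegaBar , ⊖ omegaBar , (λ ()) , (λ ()) , (λ ()) , refl

representable-omegaBar² : Representable (omegaBar ⊗ omegaBar)
representable-omegaBar² = ⊖ 1ω , ⊖ omega , ⊖ omega , (λ ()) , (λ ()) , (λ ()) , refl

data Parity (z : ℤ) : Set where
  even : (p : ℤ) → z ≡ + 2 * p → Parity z
  odd  : (p : ℤ) → z ≡ + 2 * p + + 1 → Parity z

parity : ∀ z → Parity z
parity z = classify (z %ℕ 2) (n%ℕd<d z 2) (a≡a%ℕn+[a/ℕn]*n z 2)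
  where
  q : ℤ
  q = z /ℕ 2
  classify : ∀ r → r ℕ.< 2 → z ≡ + r + q * + 2 → Parity z
  classify 0 _ z≡ = even q (trans z≡ (trans (ℤ.+-identityˡ (q * + 2)) (ℤ.*-comm q (+ 2))))
  classify 1 _ z≡ = odd q (trans z≡ (trans (ℤ.+-comm (+ 1) (q * + 2)) (cong (_+ + 1) (ℤ.*-comm q (+ 2)))))
  classify (suc (suc r)) (s≤s (s≤s ())) _

data Shape (n : ℤω) : Set where
  twice          : (h : ℤω) → n ≡ 2ω ⊗ h → Shape n
  oddMultiple    : (d K : ℤω) → normSq d ≤ + 2 → n ≡ d ⊗ (2ω ⊗ K ⊕ 1ω) → Shape n
  squareMultiple : (m d : ℤω) → Representable (d ⊗ d) → n ≡ m ⊗ (d ⊗ d) → Shape n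

coords-twice : ∀ p q → (+ 2 * p) + (+ 2 * q) ω ≡ 2ω ⊗ (p + q ω)
coords-twice p q = cong₂ _+_ω
  (solve 2 (λ p q → con (+ 2) :* p := proj₁ (2ᶠ ⊗ᶠ (p , q))) refl p q)
  (solve 2 (λ p q → con (+ 2) :* q := proj₂ (2ᶠ ⊗ᶠ (p , q))) refl p q)

coords-odd : ∀ p q → (+ 2 * p + + 1) + (+ 2 * q) ω ≡ 1ω ⊗ (2ω ⊗ (p + q ω) ⊕ 1ω)
coords-odd p q = cong₂ _+_ω
  (solve 2 (λ p q → con (+ 2) :* p :+ con (+ 1) := proj₁ (1ᶠ ⊗ᶠ (2ᶠ ⊗ᶠ (p , q) ⊕ᶠ 1ᶠ))) refl p q)
  (solve 2 (λ p q → con (+ 2) :* q := proj₂ (1ᶠ ⊗ᶠ (2ᶠ ⊗ᶠ (p , q) ⊕ᶠ 1ᶠ))) refl p q)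

coords-ω-odd : ∀ s q → (+ 2 * (+ 2 * s)) + (+ 2 * q + + 1) ω ≡ omega ⊗ (2ω ⊗ ((s + q) + (- s) ω) ⊕ 1ω)
coords-ω-odd s q = cong₂ _+_ω
  (solve 2 (λ s q → con (+ 2) :* (con (+ 2) :* s) := proj₁ (ωᶠ ⊗ᶠ (2ᶠ ⊗ᶠ ((s :+ q) , :- s) ⊕ᶠ 1ᶠ))) refl s q)
  (solve 2 (λ s q → con (+ 2) :* q :+ con (+ 1) := proj₂ (ωᶠ ⊗ᶠ (2ᶠ ⊗ᶠ ((s :+ q) , :- s) ⊕ᶠ 1ᶠ))) refl s q)

coords-ω² : ∀ s q → (+ 2 * (+ 2 * s + + 1)) + (+ 2 * q + + 1) ω ≡ ((q - s) + (- s - q - + 1) ω) ⊗ (omega ⊗ omega)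
coords-ω² s q = cong₂ _+_ω
  (solve 2 (λ s q → con (+ 2) :* (con (+ 2) :* s :+ con (+ 1)) := proj₁ (((q :- s) , (:- s :- q :- con (+ 1))) ⊗ᶠ (ωᶠ ⊗ᶠ ωᶠ))) refl s q)
  (solve 2 (λ s q → con (+ 2) :* q :+ con (+ 1) := proj₂ (((q :- s) , (:- s :- q :- con (+ 1))) ⊗ᶠ (ωᶠ ⊗ᶠ ωᶠ))) refl s q)

coords-ω̄-odd : ∀ s q → (+ 2 * (+ 2 * s + + 1 - q) + + 1) + (+ 2 * q + + 1) ω ≡ omegaBar ⊗ (2ω ⊗ ((- q - + 1) + (s + + 1) ω) ⊕ 1ω)
coords-ω̄-odd s q = cong₂ _+_ω
  (solve 2 (λ s q → con (+ 2) :* (con (+ 2) :* s :+ con (+ 1) :- q) :+ con (+ 1) := proj₁ (ω̄ᶠ ⊗ᶠ (2ᶠ ⊗ᶠ ((:- q :- con (+ 1)) , (s :+ con (+ 1))) ⊕ᶠ 1ᶠ))) refl s q)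
  (solve 2 (λ s q → con (+ 2) :* q :+ con (+ 1) := proj₂ (ω̄ᶠ ⊗ᶠ (2ᶠ ⊗ᶠ ((:- q :- con (+ 1)) , (s :+ con (+ 1))) ⊕ᶠ 1ᶠ))) refl s q)

coords-ω̄² : ∀ s q → (+ 2 * (+ 2 * s - q) + + 1) + (+ 2 * q + + 1) ω ≡ ((- (+ 2 * s) - + 1) + (s - q) ω) ⊗ (omegaBar ⊗ omegaBar)
coords-ω̄² s q = cong₂ _+_ω
  (solve 2 (λ s q → con (+ 2) :* (con (+ 2) :* s :- q) :+ con (+ 1) := proj₁ (((:- (con (+ 2) :* s) :- con (+ 1)) , (s :- q)) ⊗ᶠ (ω̄ᶠ ⊗ᶠ ω̄ᶠ))) refl s q)
  (solve 2 (λ s q → con (+ 2) :* q :+ con (+ 1) := proj₂ (((:- (con (+ 2) :* s) :- con (+ 1)) , (s :- q)) ⊗ᶠ (ω̄ᶠ ⊗ᶠ ω̄ᶠ))) refl s q)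

solve-for : ∀ {p q t} → p + q ≡ t → p ≡ t - q
solve-for {p} {q} refl = sym (ℤ-Tactic.solve (p ∷ q ∷ []))

-- x even, y odd: x + yω is divisible by ω; it is ω·(odd) or a multiple of ω²
-- according to x mod 4.
shape-ω-divisible : ∀ p q → Shape ((+ 2 * p) + (+ 2 * q + + 1) ω)
shape-ω-divisible p q with parity p
... | even s refl = oddMultiple omega ((s + q) + (- s) ω) ℤ.≤-refl (coords-ω-odd s q)
... | odd s refl  = squareMultiple ((q - s) + (- s - q - + 1) ω) omega representable-omega² (coords-ω² s q)

-- x, y odd: x + yω is divisible by ω̄; it is ω̄·(odd) or a multiple of ω̄²
-- according to the parity of (x + y)/2.
shape-ω̄-divisible : ∀ p q → Shape ((+ 2 * p + + 1) + (+ 2 * q + + 1) ω)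
shape-ω̄-divisible p q with parity (p + q)
... | odd s p+q≡ with solve-for {p} {q} p+q≡
...   | refl = oddMultiple omegaBar ((- q - + 1) + (s + + 1) ω) ℤ.≤-refl (coords-ω̄-odd s q)
shape-ω̄-divisible p q | even s p+q≡ with solve-for {p} {q} p+q≡
...   | refl = squareMultiple ((- (+ 2 * s) - + 1) + (s - q) ω) omegaBar representable-omegaBar² (coords-ω̄² s q)

shape : ∀ n → Shape n
shape (x + y ω) with parity x | parity y
... | even p refl | even q refl = twice (p + q ω) (coords-twice p q)
... | odd p refl  | even q refl = oddMultiple 1ω (p + q ω) (+≤+ (s≤s z≤n)) (coords-odd p q)
... | even p refl | odd q refl  = shape-ω-divisible p q
... | odd p refl  | odd q refl  = shape-ω̄-divisible p q

nonzero-of-large : ∀ {n} → ¬ normSq n ≤ + 2 → ¬ n ≡ 0ω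
nonzero-of-large large refl = large (+≤+ z≤n)

factors-nonzero : ∀ {n} x y → ¬ n ≡ 0ω → n ≡ x ⊗ y → ¬ x ≡ 0ω × ¬ y ≡ 0ω
factors-nonzero x y n≢0 n≡xy =
  (λ { refl → n≢0 (trans n≡xy (zeroˡ y)) }) , (λ { refl → n≢0 (trans n≡xy (zeroʳ x)) })

odd-unit : ∀ K → K ≡ 0ω ⊎ K ⊕ 1ω ≡ 0ω → normSq (2ω ⊗ K ⊕ 1ω) ≡ + 1
odd-unit K (inj₁ refl)     = refl
odd-unit K (inj₂ K+1≡0) = cong normSq (begin
  2ω ⊗ K ⊕ 1ω                ≡⟨ RingTactic.solve (K ∷ []) ℤω-ring ⟩
  2ω ⊗ (K ⊕ 1ω) ⊕ ⊖ 1ω       ≡⟨ cong (λ t → 2ω ⊗ t ⊕ ⊖ 1ω) K+1≡0 ⟩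
  2ω ⊗ 0ω ⊕ ⊖ 1ω            ∎)
  where open ≡-Reasoning

-- n = d(2K + 1) with |d|² ≤ 2 < |n|²: the odd factor is no unit, so K ≠ 0, -1.
oddMultiple-representable : ∀ {n} d K → normSq d ≤ + 2 → n ≡ d ⊗ (2ω ⊗ K ⊕ 1ω) →
                            ¬ normSq n ≤ + 2 → Representable n
oddMultiple-representable {n} d K small n≡dk large = subst Representable (sym n≡dk)
  (representable-scale d (proj₁ factors)
    (representable-odd K (λ K≡0 → not-unit (inj₁ K≡0)) (λ K+1≡0 → not-unit (inj₂ K+1≡0)) (proj₂ factors)))
  where
  factors : ¬ d ≡ 0ω × ¬ (2ω ⊗ K ⊕ 1ω) ≡ 0ω
  factors = factors-nonzero d (2ω ⊗ K ⊕ 1ω) (nonzero-of-large large) n≡dk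
  not-unit : ¬ (K ≡ 0ω ⊎ K ⊕ 1ω ≡ 0ω)
  not-unit unit = large (begin
    normSq n                                 ≡⟨ cong normSq n≡dk ⟩
    normSq (d ⊗ (2ω ⊗ K ⊕ 1ω))               ≡⟨ normSq-⊗ d (2ω ⊗ K ⊕ 1ω) ⟩
    normSq d * normSq (2ω ⊗ K ⊕ 1ω)          ≡⟨ cong (normSq d *_) (odd-unit K unit) ⟩
    normSq d * + 1                           ≡⟨ ℤ.*-identityʳ (normSq d) ⟩
    normSq d                                 ≤⟨ small ⟩
    + 2                                      ∎)
    where open ℤ.≤-Reasoning

shape-representable : ∀ {n} → Shape n → ¬ normSq n ≤ + 2 → Representable n
shape-representable (twice h n≡2h) large = subst Representable (sym n≡2h)
  (representable-twice h (proj₂ (factors-nonzero 2ω h (nonzero-of-large large) n≡2h)))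
shape-representable (oddMultiple d K small n≡dk) large = oddMultiple-representable d K small n≡dk large
shape-representable (squareMultiple m d dd-rep n≡mdd) large = subst Representable (sym n≡mdd)
  (representable-scale m (proj₁ (factors-nonzero m (d ⊗ d) (nonzero-of-large large) n≡mdd)) dd-rep)

theorem13 : (n : ℤω) → ¬ (normSq n ≤ + 2) →
    Σ ℤω (λ a → Σ ℤω (λ b → Σ ℤω (λ c →
      ¬ (a ≡ 0ω) × ¬ (b ≡ 0ω) × ¬ (c ≡ 0ω) ×
      (4ω ⊗ a ⊗ b ⊗ c ≡ n ⊗ (b ⊗ c ⊕ a ⊗ c ⊕ a ⊗ b)))))
theorem13 n large = shape-representable (shape n) large
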